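{- Let $G$ be a directed acyclic graph with $s\in V(G)$, where $s$ has out-degree at least $2$. For every edge $e=(u,v)\in E(G)$, $\mathrm{OPT}[e]=\min\{\mathrm{OPT}[w] : w\in V(G),\ w\Rightarrow u\}+1$.
   Context: For $v\in V(G)$, $\mathcal{P}_v$ is the set of all directed paths from $s$ to $v$ in $G$. A set $S\subseteq E(G)$ is a forcing set for $\mathcal{P}_v$ if there is exactly one $P\in\mathcal{P}_v$ with $S\subseteq E(P)$. For vertices $x,y$, $x\Rightarrow y$ means there is exactly one directed path from $x$ to $y$ in $G$ (so $x\Rightarrow x$ always). For an edge $e=(u,v)$, $\mathrm{OPT}[e]=\min\{|S| : S \text{ is a forcing set for } \mathcal{P}_v \text{ with } e\in S\}$; for $v\neq s$, $\mathrm{OPT}[v]=\min_{u\in N^-(v)}\mathrm{OPT}[(u,v)]$, where $N^-(v)$ is the set of in-neighbors of $v$; and $\mathrm{OPT}[s]=0$. A minimum over an empty set is $\infty$. -}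

module Defs where

open import Data.Nat using (ℕ; zero; suc; _≤_)
open import Data.Fin using (Fin)
open import Data.Bool using (Bool; true)
open import Data.List using (List; []; _∷_; length)
open import Data.List.Relation.Unary.All using (All)
open import Data.List.Relation.Unary.Unique.Propositional using (Unique)
open import Data.List.Membership.Propositional using (_∈_)
open import Data.Product using (Σ; ∃; _×_; _,_)
open import Data.Sum using (_⊎_)
open import Relation.Binary.PropositionalEquality using (_≡_; _≢_)
open import Relation.Nullary using (¬_)

record Digraph (n : ℕ) : Set where
  field
    adj : Fin n → Fin n → Bool

module _ {n : ℕ} (G : Digraph n) where
  open Digraph G

  Edge : Fin n → Fin n → Set
  Edge u v = adj u v ≡ true

  -- IsWalk x vs y : x , vs is a directed walk from x ending in y
  -- (vs = the vertices after x, in order).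
  IsWalk : Fin n → List (Fin n) → Fin n → Set
  IsWalk x []       y = x ≡ y
  IsWalk x (v ∷ vs) y = Edge x v × IsWalk v vs y

  IsPath : Fin n → List (Fin n) → Fin n → Set
  IsPath x vs y = IsWalk x vs y × Unique (x ∷ vs)

  pathEdges : Fin n → List (Fin n) → List (Fin n × Fin n)
  pathEdges x []       = []
  pathEdges x (v ∷ vs) = (x , v) ∷ pathEdges v vs

  Acyclic : Set
  Acyclic = ∀ x v vs → ¬ IsWalk x (v ∷ vs) x

  OutDegAtLeast2 : Fin n → Set
  OutDegAtLeast2 s = Σ (Fin n) λ a → Σ (Fin n) λ b → a ≢ b × Edge s a × Edge s b

ExactlyOne : {A : Set} → (A → Set) → Set
ExactlyOne {A} P = Σ A λ a → P a × (∀ b → P b → b ≡ a)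

module _ {n : ℕ} (G : Digraph n) (s : Fin n) where

  Unique⇒ : Fin n → Fin n → Set
  Unique⇒ x y = ExactlyOne (λ p → IsPath G x p y)

  -- S (a duplicate-free list of edges of G, |S| = length S) is a forcing
  -- set for 𝒫_v: exactly one s–v path P with S ⊆ E(P).
  IsForcingSet : List (Fin n × Fin n) → Fin n → Set
  IsForcingSet S v =
    Unique S × All (λ e → Edge G (Data.Product.proj₁ e) (Data.Product.proj₂ e)) S ×
    ExactlyOne (λ p → IsPath G s p v × All (λ e → e ∈ pathEdges G s p) S)

data ℕ∞ : Set where
  fin : ℕ → ℕ∞
  ∞   : ℕ∞

suc∞ : ℕ∞ → ℕ∞
suc∞ (fin k) = fin (suc k)
suc∞ ∞       = ∞

IsMin : (ℕ → Set) → ℕ∞ → Set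
IsMin P (fin k) = P k × (∀ j → P j → k ≤ j)
IsMin P ∞       = ∀ j → ¬ P j

module _ {n : ℕ} (G : Digraph n) (s : Fin n) where

  OPTₑ : Fin n → Fin n → ℕ∞ → Set
  OPTₑ u v = IsMin (λ k → Σ (List (Fin n × Fin n)) λ S →
                     IsForcingSet G s S v × (u , v) ∈ S × length S ≡ k)

  OPTᵥ : Fin n → ℕ∞ → Set
  OPTᵥ v m = (v ≡ s × m ≡ fin 0)
           ⊎ (v ≢ s × IsMin (λ k → Σ (Fin n) λ u → Edge G u v × OPTₑ u v (fin k)) m)

-- Call T anchored at w if w = s or T contains an edge entering w; an optimal forcing set for
-- w can always be taken anchored (the empty set when w = s).
--
-- OPT[e] ≤ OPT[w] + 1 for w ⇒ u: if an anchored T forces the path t to w and q is the unique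
-- w–u path, then T ∪ {(u , v)} forces t q v. Any s–v path covering T ∪ {(u , v)} passes
-- through w at the anchor; before w it covers T, since in a DAG no edge occurs both before and
-- after w on a walk, so it follows t; after w it is a w–u path followed by (u , v), so it is q v.
--
-- OPT[e] ≥ min OPT[w] + 1: if S ∋ (u , v) forces p₁ v, let w be the head of the last edge of
-- S ∖ {(u , v)} along p₁ (or s if there is none), splitting p₁ = q₁ q₂ at w. Replacing q₁ by
-- another s–w path covering S ∖ {(u , v)}, or q₂ by another w–u path, would give a second
-- s–v path covering S; so S ∖ {(u , v)} is an anchored forcing set for w, and w ⇒ u.
--
-- The minima defining OPT exist only under double negation, which suffices because the
-- conclusion is an equation between natural numbers.
module Submission where

open import Defs
open import Data.Nat using (ℕ; suc; _≤_; _<_; _≤?_; z≤n; s≤s)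
open import Data.Nat.Properties using (≤-antisym; ≤-trans; ≤-refl; <⇒≤; ≮⇒≥)
open import Data.Nat.Induction using (<-rec)
open import Data.Fin using (Fin; _≟_)
open import Data.List using (List; []; _∷_; _++_; [_]; length; filter)
open import Data.List.Properties using (++-assoc; ++-cancelˡ; ++-cancelʳ; filter-notAll)
open import Data.List.Relation.Unary.All as All using (All; []; _∷_)
open import Data.List.Relation.Unary.All.Properties using (¬Any⇒All¬)
open import Data.List.Relation.Unary.Any as Any using (here; there)
open import Data.List.Relation.Unary.AllPairs using ([]; _∷_)
open import Data.List.Relation.Unary.Unique.Propositional using (Unique)
import Data.List.Relation.Unary.Unique.Propositional.Properties as Unique
open import Data.List.Membership.Propositional using (_∈_; _∉_)
open import Data.List.Membership.Propositional.Properties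
  using (∈-++⁺ˡ; ∈-++⁺ʳ; ∈-++⁻; ∈-filter⁺; ∈-filter⁻)
open import Data.Product using (Σ; _×_; _,_; proj₁; map₂)
open import Data.Product.Properties using (≡-dec)
open import Data.Sum using (_⊎_; inj₁; inj₂)
open import Data.Empty using (⊥; ⊥-elim)
open import Effect.Monad using (RawMonad)
open import Level using (0ℓ)
open import Relation.Nullary using (¬_; yes; no; ¬?; contradiction)
open import Relation.Nullary.Decidable using (decidable-stable; ¬¬-excluded-middle)
open import Relation.Nullary.Negation using (¬¬-Monad; ¬¬-map)
open import Relation.Unary using (Decidable)
open import Relation.Binary.Definitions using (DecidableEquality)
open import Relation.Binary.PropositionalEquality using (_≡_; _≢_; refl; sym; trans; cong; cong₂)

open RawMonad (¬¬-Monad {a = 0ℓ})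

minimum-exists : (P : ℕ → Set) {j : ℕ} → P j → ¬ ¬ (Σ ℕ λ k → IsMin P (fin k) × k ≤ j)
minimum-exists P {j} = <-rec Goal search j
  where
  Goal : ℕ → Set
  Goal j = P j → ¬ ¬ (Σ ℕ λ k → IsMin P (fin k) × k ≤ j)

  search : ∀ j → (∀ {i} → i < j → Goal i) → Goal j
  search j smaller pj = do
    yes (i , i<j , pi) ← ¬¬-excluded-middle {A = Σ ℕ λ i → i < j × P i}
      where no none → pure (j , (pj , λ i pi → ≮⇒≥ λ i<j → none (i , i<j , pi)) , ≤-refl)
    (k , minimal , k≤i) ← smaller i<j pi
    pure (k , minimal , ≤-trans k≤i (<⇒≤ i<j))

module Walks {n : ℕ} (G : Digraph n) where

  private variable
    a b x y z : Fin n
    p q : List (Fin n)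
    f : Fin n × Fin n

  walk-++ : IsWalk G x p y → IsWalk G y q z → IsWalk G x (p ++ q) z
  walk-++ {p = []}    refl       wq = wq
  walk-++ {p = _ ∷ _} (xc , wp) wq = xc , walk-++ wp wq

  pathEdges-++ : IsWalk G x p y → pathEdges G x (p ++ q) ≡ pathEdges G x p ++ pathEdges G y q
  pathEdges-++ {p = []}              refl     = refl
  pathEdges-++ {x = x} {p = c ∷ _} (_ , wp) = cong ((x , c) ∷_) (pathEdges-++ wp)

  ∈-pathEdges-++⁺ˡ : IsWalk G x p y → f ∈ pathEdges G x p → f ∈ pathEdges G x (p ++ q)
  ∈-pathEdges-++⁺ˡ {q = q} wp m rewrite pathEdges-++ {q = q} wp = ∈-++⁺ˡ m

  ∈-pathEdges-++⁺ʳ : IsWalk G x p y → f ∈ pathEdges G y q → f ∈ pathEdges G x (p ++ q)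
  ∈-pathEdges-++⁺ʳ {x = x} {p = p} {q = q} wp m rewrite pathEdges-++ {q = q} wp =
    ∈-++⁺ʳ (pathEdges G x p) m

  ∈-pathEdges-++⁻ : IsWalk G x p y → f ∈ pathEdges G x (p ++ q) →
                    f ∈ pathEdges G x p ⊎ f ∈ pathEdges G y q
  ∈-pathEdges-++⁻ {x = x} {p = p} {q = q} wp m rewrite pathEdges-++ {q = q} wp =
    ∈-++⁻ (pathEdges G x p) m

  ∈⇒∈-pathEdges : z ∈ p → Σ (Fin n) λ a → (a , z) ∈ pathEdges G x p
  ∈⇒∈-pathEdges {x = x} (here refl) = x , here refl
  ∈⇒∈-pathEdges         (there m)   = map₂ there (∈⇒∈-pathEdges m)

  split-at-edge : IsWalk G x p y → (a , b) ∈ pathEdges G x p →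
    Σ (List (Fin n)) λ p₁ → Σ (List (Fin n)) λ p₂ →
      p ≡ p₁ ++ b ∷ p₂ × IsWalk G x p₁ a × Edge G a b × IsWalk G b p₂ y
  split-at-edge {p = c ∷ p} (xc , wp) (here refl) = [] , p , refl , refl , xc , wp
  split-at-edge {p = c ∷ p} (xc , wp) (there m) with split-at-edge wp m
  ... | p₁ , p₂ , refl , wp₁ , ab , wp₂ = c ∷ p₁ , p₂ , refl , (xc , wp₁) , ab , wp₂

  split-at-head : IsWalk G x p y → (a , b) ∈ pathEdges G x p →
    Σ (List (Fin n)) λ p₁ → Σ (List (Fin n)) λ p₂ →
      p ≡ p₁ ++ p₂ × IsWalk G x p₁ b × IsWalk G b p₂ y
  split-at-head {b = b} wp m with split-at-edge wp m
  ... | p₁ , p₂ , refl , wp₁ , ab , wp₂ =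
    p₁ ++ [ b ] , p₂ , sym (++-assoc p₁ [ b ] p₂) , walk-++ wp₁ (ab , refl) , wp₂

  split-after-last : {M : Fin n × Fin n → Set} → Decidable M → IsWalk G x q y →
    Σ (Fin n) λ w → Σ (List (Fin n)) λ q₁ → Σ (List (Fin n)) λ q₂ →
      q ≡ q₁ ++ q₂ × IsWalk G x q₁ w × IsWalk G w q₂ y ×
      (∀ {f} → M f → f ∈ pathEdges G x q → f ∈ pathEdges G x q₁) ×
      (q₁ ≡ [] ⊎ Σ (Fin n) λ c → M (c , w))
  split-after-last {q = []} M? refl = _ , [] , [] , refl , refl , refl , (λ _ m → m) , inj₁ refl
  split-after-last {x = x} {q = c ∷ q} M? (xc , wq) with split-after-last M? wq
  ... | w , q₁ , q₂ , refl , wq₁ , wq₂ , inside , inj₂ last =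
    w , c ∷ q₁ , q₂ , refl , (xc , wq₁) , wq₂ ,
    (λ { _ (here refl) → here refl ; Mf (there m) → there (inside Mf m) }) , inj₂ last
  ... | _ , [] , q₂ , refl , refl , wq₂ , inside , inj₁ refl with M? (x , c)
  ...   | yes Mxc = c , [ c ] , q₂ , refl , (xc , refl) , wq₂ ,
                    (λ { _ (here refl) → here refl ; Mf (there m) → there (inside Mf m) }) ,
                    inj₂ (x , Mxc)
  ...   | no ¬Mxc = x , [] , c ∷ q₂ , refl , refl , (xc , wq₂) ,
                    (λ { Mf (here refl) → contradiction Mf ¬Mxc ; Mf (there m) → inside Mf m }) ,
                    inj₁ refl

module DAG {n : ℕ} (G : Digraph n) (acyclic : Acyclic G) where
  open Walks G

  private variable
    a b u v w x y z : Fin n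
    p q : List (Fin n)
    f : Fin n × Fin n

  no-cycle : IsWalk G b q x → IsWalk G x p a → Edge G a b → ⊥
  no-cycle {q = q} wq wp ab = acyclic _ _ (q ++ _) (ab , walk-++ wq wp)

  closed-walk-empty : IsWalk G x p x → p ≡ []
  closed-walk-empty {p = []}    _  = refl
  closed-walk-empty {p = c ∷ p} wp = ⊥-elim (acyclic _ c p wp)

  walk⇒path : IsWalk G x p y → IsPath G x p y
  walk⇒path wp = wp , unique wp
    where
    not-revisited : IsWalk G x p y → x ∉ p
    not-revisited wp x∈p with ∈⇒∈-pathEdges x∈p
    ... | _ , m with split-at-edge wp m
    ...   | _ , _ , _ , wp₁ , ax , _ = no-cycle refl wp₁ ax

    unique : IsWalk G x p y → Unique (x ∷ p)
    unique {p = []}    _           = [] ∷ []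
    unique {p = _ ∷ _} wp@(_ , wq) = ¬Any⇒All¬ _ (not-revisited wp) ∷ unique wq

  split-last-edge : IsWalk G x p v → (u , v) ∈ pathEdges G x p →
    Σ (List (Fin n)) λ p₁ → p ≡ p₁ ++ [ v ] × IsWalk G x p₁ u
  split-last-edge wp m with split-at-edge wp m
  ... | p₁ , p₂ , refl , wp₁ , _ , wp₂ rewrite closed-walk-empty wp₂ = p₁ , refl , wp₁

  pathEdges-disjoint : IsWalk G x p w → IsWalk G w q z →
                       f ∈ pathEdges G x p → f ∈ pathEdges G w q → ⊥
  pathEdges-disjoint wp wq f∈p f∈q with split-at-edge wp f∈p | split-at-edge wq f∈q
  ... | _ , _ , _ , _ , _ , wp₂ | _ , _ , _ , wq₁ , ab , _ = no-cycle wp₂ wq₁ ab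

module Forcing {n : ℕ} (G : Digraph n) (s : Fin n) (acyclic : Acyclic G) where
  open Walks G
  open DAG G acyclic

  private variable
    u v w : Fin n
    k : ℕ
    r : List (Fin n)
    S T : List (Fin n × Fin n)

  Covers : List (Fin n) → List (Fin n × Fin n) → Set
  Covers p T = All (_∈ pathEdges G s p) T

  Anchored : List (Fin n × Fin n) → Fin n → Set
  Anchored T w = w ≡ s ⊎ Σ (Fin n) λ c → (c , w) ∈ T

  ForcingSetWith : Fin n → Fin n → ℕ → Set
  ForcingSetWith u v k = Σ (List (Fin n × Fin n)) λ S →
    IsForcingSet G s S v × (u , v) ∈ S × length S ≡ k

  UniqueAncestorOPT : Fin n → ℕ → Set
  UniqueAncestorOPT u k = Σ (Fin n) λ w → Unique⇒ G s w u × OPTᵥ G s w (fin k)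

  empty-forcing-source : IsForcingSet G s [] s
  empty-forcing-source = [] , [] , [] , (walk⇒path refl , []) ,
                         λ r (pr , _) → closed-walk-empty (proj₁ pr)

  split-at-anchor : Anchored T w → IsWalk G s r v → Covers r T →
    Σ (List (Fin n)) λ r₁ → Σ (List (Fin n)) λ r₂ →
      r ≡ r₁ ++ r₂ × IsWalk G s r₁ w × IsWalk G w r₂ v
  split-at-anchor (inj₁ refl)       wr _   = [] , _ , refl , refl , wr
  split-at-anchor (inj₂ (_ , cw∈T)) wr cov = split-at-head wr (All.lookup cov cw∈T)

  extend : IsForcingSet G s T w → Anchored T w → Unique⇒ G s w u → Edge G u v →
           IsForcingSet G s ((u , v) ∷ T) v
  extend {T} {w} {u} {v} (uniqT , edgesT , t , ((wt , _) , covT) , forcedT) anchor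
         (q , (wq , _) , forcedQ) uv =
    ¬Any⇒All¬ T uv∉T ∷ uniqT , uv ∷ edgesT ,
    t ++ q ++ [ v ] ,
    (walk⇒path (walk-++ wt wqv) , ∈-pathEdges-++⁺ʳ wt uv∈qv ∷ All.map (∈-pathEdges-++⁺ˡ wt) covT) ,
    forced
    where
    wqv : IsWalk G w (q ++ [ v ]) v
    wqv = walk-++ wq (uv , refl)

    uv∈qv : (u , v) ∈ pathEdges G w (q ++ [ v ])
    uv∈qv = ∈-pathEdges-++⁺ʳ wq (here refl)

    uv∉T : (u , v) ∉ T
    uv∉T uv∈T = pathEdges-disjoint wt wqv (All.lookup covT uv∈T) uv∈qv

    forced : ∀ r → IsPath G s r v × Covers r ((u , v) ∷ T) → r ≡ t ++ q ++ [ v ]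
    forced r ((wr , _) , uv∈r ∷ covT′) with split-at-anchor anchor wr covT′
    ... | r₁ , r₂ , refl , wr₁ , wr₂ = cong₂ _++_ r₁≡t r₂≡qv
      where
      T-before-w : ∀ {f} → f ∈ T → f ∈ pathEdges G s r₁
      T-before-w f∈T with ∈-pathEdges-++⁻ wr₁ (All.lookup covT′ f∈T)
      ... | inj₁ m = m
      ... | inj₂ m = ⊥-elim (pathEdges-disjoint wt wr₂ (All.lookup covT f∈T) m)

      r₁≡t : r₁ ≡ t
      r₁≡t = forcedT r₁ (walk⇒path wr₁ , All.tabulate T-before-w)

      r₂≡qv : r₂ ≡ q ++ [ v ]
      r₂≡qv with ∈-pathEdges-++⁻ wr₁ uv∈r
      ... | inj₁ m = ⊥-elim (pathEdges-disjoint wr₁ wqv m uv∈qv)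
      ... | inj₂ m with split-last-edge wr₂ m
      ...   | r₃ , refl , wr₃ = cong (_++ [ v ]) (forcedQ r₃ (walk⇒path wr₃))

  _≟ₑ_ : DecidableEquality (Fin n × Fin n)
  _≟ₑ_ = ≡-dec _≟_ _≟_

  open import Data.List.Membership.DecPropositional _≟ₑ_ using (_∈?_)

  differs : (e : Fin n × Fin n) → Decidable (_≢ e)
  differs e f = ¬? (f ≟ₑ e)

  restrict : IsForcingSet G s S v → (u , v) ∈ S →
    Σ (Fin n) λ w → Σ (List (Fin n × Fin n)) λ S′ →
      Unique⇒ G s w u × IsForcingSet G s S′ w × Anchored S′ w × suc (length S′) ≤ length S
  restrict {S} {v} {u} (uniqS , edgesS , p , ((wp , _) , covS) , forcedS) uv∈S
    with split-last-edge wp (All.lookup covS uv∈S)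
  ... | p₁ , refl , wp₁
    with split-after-last (_∈? filter (differs (u , v)) S) wp₁
  ... | w , q₁ , q₂ , refl , wq₁ , wq₂ , inside , last =
    w , S′ , w⇒u , forcesS′ , anchored last ,
    filter-notAll (differs (u , v)) S (Any.map (λ uv≡f f≢uv → f≢uv (sym uv≡f)) uv∈S)
    where
    S′ = filter (differs (u , v)) S

    S′-in-p₁ : ∀ {f} → f ∈ S′ → f ∈ pathEdges G s p₁
    S′-in-p₁ m with ∈-filter⁻ (differs (u , v)) m
    ... | f∈S , f≢uv with ∈-pathEdges-++⁻ wp₁ (All.lookup covS f∈S)
    ...   | inj₁ m′ = m′
    ...   | inj₂ (here f≡uv) = contradiction f≡uv f≢uv

    S′-in-q₁ : ∀ {f} → f ∈ S′ → f ∈ pathEdges G s q₁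
    S′-in-q₁ m = inside m (S′-in-p₁ m)

    forced-through-w : ∀ {r t} → IsWalk G s r w → IsWalk G w t u → Covers r S′ →
                       r ++ t ++ [ v ] ≡ q₁ ++ q₂ ++ [ v ]
    forced-through-w {r} {t} wr wt covS′ =
      trans (forcedS _ (walk⇒path wrtv , All.tabulate covers)) (++-assoc q₁ q₂ [ v ])
      where
      wrtv = walk-++ wr (walk-++ wt (All.lookup edgesS uv∈S , refl))
      covers : ∀ {f} → f ∈ S → f ∈ pathEdges G s (r ++ t ++ [ v ])
      covers {f} f∈S with f ≟ₑ (u , v)
      ... | yes refl = ∈-pathEdges-++⁺ʳ wr (∈-pathEdges-++⁺ʳ wt (here refl))
      ... | no f≢uv = ∈-pathEdges-++⁺ˡ wr (All.lookup covS′ (∈-filter⁺ (differs (u , v)) f∈S f≢uv))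

    w⇒u : Unique⇒ G s w u
    w⇒u = q₂ , walk⇒path wq₂ , λ t (wt , _) →
      ++-cancelʳ [ v ] t q₂ (++-cancelˡ q₁ _ _ (forced-through-w wq₁ wt (All.tabulate S′-in-q₁)))

    forcesS′ : IsForcingSet G s S′ w
    forcesS′ =
      Unique.filter⁺ (differs (u , v)) uniqS ,
      All.tabulate (λ m → All.lookup edgesS (proj₁ (∈-filter⁻ (differs (u , v)) m))) ,
      q₁ , (walk⇒path wq₁ , All.tabulate S′-in-q₁) ,
      λ r ((wr , _) , covS′) → ++-cancelʳ (q₂ ++ [ v ]) r q₁ (forced-through-w wr wq₂ covS′)

    anchored : q₁ ≡ [] ⊎ Σ (Fin n) (λ c → (c , w) ∈ S′) → Anchored S′ w
    anchored (inj₁ refl) = inj₁ (sym wq₁)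
    anchored (inj₂ last) = inj₂ last

  optᵥ-witness : OPTᵥ G s w (fin k) →
    Σ (List (Fin n × Fin n)) λ T → IsForcingSet G s T w × Anchored T w × length T ≡ k
  optᵥ-witness (inj₁ (refl , refl)) = [] , empty-forcing-source , inj₁ refl , refl
  optᵥ-witness (inj₂ (_ , (c , _ , (T , forcesT , cw∈T , refl) , _) , _)) =
    T , forcesT , inj₂ (c , cw∈T) , refl

  optᵥ-bound : IsForcingSet G s T w → Anchored T w →
               ¬ ¬ (Σ ℕ λ k → OPTᵥ G s w (fin k) × k ≤ length T)
  optᵥ-bound {w = w} forcesT@(_ , edgesT , _) anchor with w ≟ s | anchor
  ... | yes refl | _               = pure (0 , inj₁ (refl , refl) , z≤n)
  ... | no w≢s   | inj₁ w≡s        = contradiction w≡s w≢s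
  ... | no w≢s   | inj₂ (c , cw∈T) = do
    (k₁ , optₑ , k₁≤) ← minimum-exists (ForcingSetWith c w) (_ , forcesT , cw∈T , refl)
    (k₂ , optᵥ , k₂≤) ← minimum-exists _ (c , All.lookup edgesT cw∈T , optₑ)
    pure (k₂ , inj₂ (w≢s , optᵥ) , ≤-trans k₂≤ k₁≤)

  optₑ-upper : UniqueAncestorOPT u k → Edge G u v → ForcingSetWith u v (suc k)
  optₑ-upper (_ , w⇒u , optᵥ) uv with optᵥ-witness optᵥ
  ... | T , forcesT , anchor , refl = _ , extend forcesT anchor w⇒u uv , here refl , refl

  optₑ-lower : IsForcingSet G s S v → (u , v) ∈ S →
    ¬ ¬ (Σ ℕ λ k → UniqueAncestorOPT u k × suc k ≤ length S)
  optₑ-lower forcesS uv∈S with restrict forcesS uv∈S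
  ... | w , S′ , w⇒u , forcesS′ , anchor , shorter = do
    (k , optᵥ , k≤) ← optᵥ-bound forcesS′ anchor
    pure (k , (w , w⇒u , optᵥ) , ≤-trans (s≤s k≤) shorter)

lemma2 : (n : ℕ) (G : Digraph n) (s : Fin n) →
         Acyclic G → OutDegAtLeast2 G s →
         (u v : Fin n) → Edge G u v →
         (x y : ℕ∞) →
         OPTₑ G s u v x →
         IsMin (λ k → Σ (Fin n) λ w → Unique⇒ G s w u × OPTᵥ G s w (fin k)) y →
         x ≡ suc∞ y
lemma2 n G s acyclic _ u v uv (fin a) (fin b)
       ((S , forcesS , uv∈S , refl) , a-least) (opt-b , b-least) =
  cong fin (≤-antisym (a-least (suc b) (optₑ-upper opt-b uv)) (decidable-stable (_ ≤? _) b<|S|))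
  where
  open Forcing G s acyclic
  b<|S| : ¬ ¬ (suc b ≤ length S)
  b<|S| = ¬¬-map (λ (k , opt-k , k<) → ≤-trans (s≤s (b-least k opt-k)) k<)
                 (optₑ-lower forcesS uv∈S)
lemma2 n G s acyclic _ u v uv (fin a) ∞ ((S , forcesS , uv∈S , _) , _) no-y =
  ⊥-elim (Forcing.optₑ-lower G s acyclic forcesS uv∈S λ (k , opt-k , _) → no-y k opt-k)
lemma2 n G s acyclic _ u v uv ∞ (fin b) no-x (opt-b , _) =
  ⊥-elim (no-x (suc b) (Forcing.optₑ-upper G s acyclic opt-b uv))
lemma2 n G s acyclic _ u v uv ∞ ∞ _ _ = refl
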